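{- Let $\alpha$ be a nondegenerate $d$-simplex in the $d$-cube and let $j>0$. Then $\alpha$ cannot have exterior $j$-faces contained in two different parallel $j$-faces of the cube. Consequently, for each nonempty set $S$ of coordinates, at most one exterior face of $\alpha$ has $S$ as its set of cube-face coordinates.
   Context: A nondegenerate $d$-simplex in the $d$-cube is the convex hull of $d+1$ affinely independent points of $\{0,1\}^d$. A $j$-face of the cube $[0,1]^d$ is obtained by fixing $d-j$ specified coordinates to specified values in $\{0,1\}$; two $j$-faces are parallel if they fix the same set of coordinates. A $j$-face of a simplex is the convex hull of $j+1$ of its vertices; it is exterior if it is contained in some $j$-face of the cube. For an exterior face $\tau$, its set of cube-face coordinates is the set of coordinates on which the vertices of $\tau$ are not all equal (for an exterior $j$-face this set has exactly $j$ elements). -}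

module Defs where

open import Data.Nat using (ℕ; zero; suc; _+_; _<_)
open import Data.Bool using (Bool; true; false)
open import Data.Fin using (Fin; zero; suc)
open import Data.Fin.Subset using (Subset; _∈_; ∣_∣; Nonempty)
open import Data.Rational using (ℚ; 0ℚ; 1ℚ) renaming (_+_ to _+ℚ_; _*_ to _*ℚ_)
open import Data.Product using (Σ; ∃; _×_)
open import Relation.Binary.PropositionalEquality using (_≡_; _≢_)

Point : ℕ → Set
Point d = Fin d → Bool

Vertices : ℕ → Set
Vertices d = Fin (suc d) → Point d

toℚ : Bool → ℚ
toℚ true  = 1ℚ
toℚ false = 0ℚ

sumℚ : (n : ℕ) → (Fin n → ℚ) → ℚ
sumℚ zero    f = 0ℚ
sumℚ (suc n) f = f zero +ℚ sumℚ n (λ i → f (suc i))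

AffinelyIndependent : {d m : ℕ} → (Fin m → Point d) → Set
AffinelyIndependent {d} {m} v =
  (λ′ : Fin m → ℚ) →
  sumℚ m λ′ ≡ 0ℚ →
  (∀ (k : Fin d) → sumℚ m (λ i → λ′ i *ℚ toℚ (v i k)) ≡ 0ℚ) →
  ∀ i → λ′ i ≡ 0ℚ

NondegSimplex : ℕ → Set
NondegSimplex d = Σ (Vertices d) AffinelyIndependent

-- The j-face of the cube fixing the coordinates in C to the values c
-- (meaningful as a j-face when ∣ C ∣ + j ≡ d) contains the vertex set T
-- of a face of the simplex.
InCubeFace : {d : ℕ} → Vertices d → Subset (suc d) →
             Subset d → Point d → Set
InCubeFace v T C c = ∀ i k → i ∈ T → k ∈ C → v i k ≡ c k

IsExteriorFace : {d : ℕ} → Vertices d → ℕ → Subset (suc d) → Set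
IsExteriorFace {d} v j T =
  ∣ T ∣ ≡ suc j ×
  ∃ λ (C : Subset d) → ∃ λ (c : Point d) → (∣ C ∣ + j ≡ d) × InCubeFace v T C c

CubeFaceCoords : {d : ℕ} → Vertices d → Subset (suc d) → Subset d → Set
CubeFaceCoords {d} v T S =
  ∀ (k : Fin d) →
    (k ∈ S → ∃ λ i → ∃ λ i′ → i ∈ T × i′ ∈ T × v i k ≢ v i′ k) ×
    ((∃ λ i → ∃ λ i′ → i ∈ T × i′ ∈ T × v i k ≢ v i′ k) → k ∈ S)

{-# OPTIONS --safe #-}
module Submission where

-- Let F be a set of coordinates and U a set of vertices of the simplex such that on U every
-- coordinate outside F is an affine function of some coordinate in F. Then the points of U lie
-- in an affine space of dimension ∣ F ∣, so affine independence forces ∣ U ∣ ≤ ∣ F ∣ + 1; over ℚ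
-- this is Gaussian elimination applied to the vectors (1, v i), i ∈ U, restricted to F.
--
-- Vertex sets T₁, T₂ lying in two distinct parallel cube faces with free coordinates F are
-- separated by a fixed coordinate k₀, and on T₁ ∪ T₂ every other fixed coordinate is an affine
-- function of k₀. Hence ∣ T₁ ∣ + ∣ T₂ ∣ ≤ ∣ F ∣ + 2, which is impossible once both sets are larger
-- than ∣ F ∣ ≥ 1. An exterior face with cube-face coordinates S has more than ∣ S ∣ vertices and
-- lies in a cube face with free coordinates S. So, as S ≠ ∅, two such faces lie in a common cube
-- face, which contains at most ∣ S ∣ + 1 vertices of the simplex; hence each contains the other.

open import Defs
open import Data.Nat using (ℕ; zero; suc; _+_; _∸_; _<_; _≤_; s≤s)
import Data.Nat.Properties as ℕ
open import Data.Bool using (Bool; true; false)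
import Data.Bool.Properties as Bool
open import Data.Fin using (Fin; zero; suc)
open import Data.Fin.Properties using (any?)
open import Data.Fin.Subset using (Subset; _∈_; _∉_; _⊆_; _∪_; _─_; _-_; ∁; ⁅_⁆; ∣_∣; inside; outside; Nonempty)
open import Data.Fin.Subset.Properties using (_∈?_; p─⊥≡p; p─q⊆p; x∈⁅x⁆; x∈⁅y⁆⇒x≡y; x∉⁅y⁆⇒x≢y; ∣⁅x⁆∣≡1; x∈p∪q⁻; x∈p∪q⁺; ∣p∣≤∣p∪q∣; ⊆-antisym; ∣∁p∣≡n∸∣p∣; p⊆q⇒∣p∣≤∣q∣; x∉p⇒x∈∁p; x∉∁p⇒x∈p; x∈p⇒x∉∁p; x∈∁p⇒x∉p; x∈p⇒∣p-x∣<∣p∣)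
open import Data.Vec using ([]; _∷_; here; there)
open import Data.Rational using (ℚ; 0ℚ; 1ℚ) renaming (_+_ to _+ℚ_; _*_ to _*ℚ_; _-_ to _-ℚ_; -_ to -ℚ_)
open import Data.Rational.Properties using (+-*-ring; heytingCommutativeRing; 1≢0; *-identityˡ; *-identityʳ; *-zeroˡ; *-zeroʳ; +-identityˡ; +-identityʳ) renaming (_≟_ to _≟ℚ_)
open import Data.Rational.Solver using (module +-*-Solver)
open import Algebra.Bundles using (Ring)
open import Algebra.Properties.Semiring.Sum (Ring.semiring +-*-ring) using (sum; sum-cong-≗; ∑-distrib-+; *-distribˡ-sum; sum-replicate-zero)
open import Algebra.Apartness.Properties.HeytingCommutativeRing heytingCommutativeRing using (x#0y#0→xy#0)
open import Data.Empty using (⊥; ⊥-elim)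
open import Data.Product using (∃; ∃₂; _×_; _,_; proj₁; proj₂)
open import Data.Sum using (inj₁; inj₂)
open import Function using (_∘_)
open import Relation.Binary.PropositionalEquality using (_≡_; _≢_; refl; sym; trans; cong; cong₂; subst; module ≡-Reasoning)
open import Relation.Nullary using (¬_; yes; no; ¬?; contradiction)
open import Relation.Nullary.Decidable using (_×-dec_; decidable-stable)
open +-*-Solver

2+m<a+b : ∀ {m a b} → 0 < m → m < a → m < b → 2 + m < a + b
2+m<a+b {m} {a} {b} 0<m m<a m<b = begin-strict
  2 + m      <⟨ ℕ.n<1+n (2 + m) ⟩
  2 + suc m  ≡⟨ ℕ.+-comm 2 (suc m) ⟩
  suc m + 2  ≤⟨ ℕ.+-mono-≤ m<a (ℕ.≤-trans (s≤s 0<m) m<b) ⟩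
  a + b      ∎
  where open ℕ.≤-Reasoning

sumℚ≡sum : ∀ n (f : Fin n → ℚ) → sumℚ n f ≡ sum f
sumℚ≡sum zero    f = refl
sumℚ≡sum (suc n) f = cong (f zero +ℚ_) (sumℚ≡sum n (λ i → f (suc i)))

∑-zero : ∀ {n} {f : Fin n → ℚ} → (∀ i → f i ≡ 0ℚ) → sum f ≡ 0ℚ
∑-zero {n} f≗0 = trans (sum-cong-≗ f≗0) (sum-replicate-zero n)

∑-linear : ∀ {n} (a b : ℚ) (f g : Fin n → ℚ) →
           sum (λ i → a *ℚ f i +ℚ b *ℚ g i) ≡ a *ℚ sum f +ℚ b *ℚ sum g
∑-linear a b f g = begin
  sum (λ i → a *ℚ f i +ℚ b *ℚ g i)
    ≡⟨ ∑-distrib-+ (λ i → a *ℚ f i) (λ i → b *ℚ g i) ⟩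
  sum (λ i → a *ℚ f i) +ℚ sum (λ i → b *ℚ g i)
    ≡⟨ sym (cong₂ _+ℚ_ (*-distribˡ-sum a f) (*-distribˡ-sum b g)) ⟩
  a *ℚ sum f +ℚ b *ℚ sum g
    ∎
  where open ≡-Reasoning

δ : ∀ {n} → Fin n → Fin n → ℚ
δ zero    zero    = 1ℚ
δ zero    (suc i) = 0ℚ
δ (suc p) zero    = 0ℚ
δ (suc p) (suc i) = δ p i

δ-diag : ∀ {n} (p : Fin n) → δ p p ≡ 1ℚ
δ-diag zero    = refl
δ-diag (suc p) = δ-diag p

δ-≢ : ∀ {n} {p i : Fin n} → p ≢ i → δ p i ≡ 0ℚ
δ-≢ {p = zero}  {zero}  p≢i = contradiction refl p≢i
δ-≢ {p = zero}  {suc i} p≢i = refl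
δ-≢ {p = suc p} {zero}  p≢i = refl
δ-≢ {p = suc p} {suc i} p≢i = δ-≢ (p≢i ∘ cong suc)

∑-δ : ∀ {n} (p : Fin n) (f : Fin n → ℚ) → sum (λ i → δ p i *ℚ f i) ≡ f p
∑-δ zero    f = trans (cong₂ _+ℚ_ (*-identityˡ (f zero)) (∑-zero (λ i → *-zeroˡ (f (suc i)))))
                      (+-identityʳ (f zero))
∑-δ (suc p) f = trans (cong₂ _+ℚ_ (*-zeroˡ (f zero)) (∑-δ p (λ i → f (suc i))))
                      (+-identityˡ (f (suc p)))

∑-[aμ+bδ]*y : ∀ {n} (a b : ℚ) (μ y : Fin n → ℚ) (p : Fin n) →
              sum (λ i → (a *ℚ μ i +ℚ b *ℚ δ p i) *ℚ y i) ≡ a *ℚ sum (λ i → μ i *ℚ y i) +ℚ b *ℚ y p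
∑-[aμ+bδ]*y a b μ y p = begin
  sum (λ i → (a *ℚ μ i +ℚ b *ℚ δ p i) *ℚ y i)
    ≡⟨ sum-cong-≗ (λ i → solve 5 (λ a b m d y → (a :* m :+ b :* d) :* y
                                               := a :* (m :* y) :+ b :* (d :* y))
                                 refl a b (μ i) (δ p i) (y i)) ⟩
  sum (λ i → a *ℚ (μ i *ℚ y i) +ℚ b *ℚ (δ p i *ℚ y i))
    ≡⟨ ∑-linear a b (λ i → μ i *ℚ y i) (λ i → δ p i *ℚ y i) ⟩
  a *ℚ sum (λ i → μ i *ℚ y i) +ℚ b *ℚ sum (λ i → δ p i *ℚ y i)
    ≡⟨ cong (λ t → a *ℚ sum (λ i → μ i *ℚ y i) +ℚ b *ℚ t) (∑-δ p y) ⟩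
  a *ℚ sum (λ i → μ i *ℚ y i) +ℚ b *ℚ y p
    ∎
  where open ≡-Reasoning

x∈p─q⇒x∉q : ∀ {n} (p q : Subset n) {x} → x ∈ p ─ q → x ∉ q
x∈p─q⇒x∉q (inside ∷ p) (outside ∷ q) here ()
x∈p─q⇒x∉q (_ ∷ p)      (_ ∷ q)       (there x∈p─q) (there x∈q) = x∈p─q⇒x∉q p q x∈p─q x∈q

∣p∣≤1+∣p-x∣ : ∀ {n} (p : Subset n) (x : Fin n) → ∣ p ∣ ≤ suc ∣ p - x ∣
∣p∣≤1+∣p-x∣ (inside  ∷ p) zero    = ℕ.≤-reflexive (cong (suc ∘ ∣_∣) (sym (p─⊥≡p p)))
∣p∣≤1+∣p-x∣ (outside ∷ p) zero    = ℕ.m≤n⇒m≤1+n (ℕ.≤-reflexive (cong ∣_∣ (sym (p─⊥≡p p))))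
∣p∣≤1+∣p-x∣ (inside  ∷ p) (suc x) = s≤s (∣p∣≤1+∣p-x∣ p x)
∣p∣≤1+∣p-x∣ (outside ∷ p) (suc x) = ∣p∣≤1+∣p-x∣ p x

<∣p∣⇒Nonempty : ∀ {n m} (p : Subset n) → m < ∣ p ∣ → Nonempty p
<∣p∣⇒Nonempty (inside  ∷ p) _ = zero , here
<∣p∣⇒Nonempty (outside ∷ p) m<∣p∣ with <∣p∣⇒Nonempty p m<∣p∣
... | x , x∈p = suc x , there x∈p

Nonempty⇒0<∣p∣ : ∀ {n} {p : Subset n} → Nonempty p → 0 < ∣ p ∣
Nonempty⇒0<∣p∣ (x , x∈p) = ℕ.<-≤-trans ℕ.0<1+n (x∈p⇒∣p-x∣<∣p∣ x∈p)

disjoint-tail : ∀ {n s t} {p q : Subset n} → (∀ {x} → x ∈ s ∷ p → x ∉ t ∷ q) → ∀ {x} → x ∈ p → x ∉ q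
disjoint-tail disjoint x∈p x∈q = disjoint (there x∈p) (there x∈q)

∣p∪q∣≡∣p∣+∣q∣ : ∀ {n} (p q : Subset n) → (∀ {x} → x ∈ p → x ∉ q) → ∣ p ∪ q ∣ ≡ ∣ p ∣ + ∣ q ∣
∣p∪q∣≡∣p∣+∣q∣ []            []            _        = refl
∣p∪q∣≡∣p∣+∣q∣ (inside  ∷ p) (inside  ∷ q) disjoint = contradiction here (disjoint here)
∣p∪q∣≡∣p∣+∣q∣ (inside  ∷ p) (outside ∷ q) disjoint = cong suc (∣p∪q∣≡∣p∣+∣q∣ p q (disjoint-tail disjoint))
∣p∪q∣≡∣p∣+∣q∣ (outside ∷ p) (inside  ∷ q) disjoint =
  trans (cong suc (∣p∪q∣≡∣p∣+∣q∣ p q (disjoint-tail disjoint))) (sym (ℕ.+-suc ∣ p ∣ ∣ q ∣))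
∣p∪q∣≡∣p∣+∣q∣ (outside ∷ p) (outside ∷ q) disjoint = ∣p∪q∣≡∣p∣+∣q∣ p q (disjoint-tail disjoint)

∣p∪q∣≤∣p∣⇒q⊆p : ∀ {n} (p q : Subset n) → ∣ p ∪ q ∣ ≤ ∣ p ∣ → q ⊆ p
∣p∪q∣≤∣p∣⇒q⊆p (outside ∷ p) (inside  ∷ q) ∣p∪q∣<∣p∣ _ =
  contradiction (∣p∣≤∣p∪q∣ p q) (ℕ.<⇒≱ ∣p∪q∣<∣p∣)
∣p∪q∣≤∣p∣⇒q⊆p (inside  ∷ p) (_       ∷ q) _ here = here
∣p∪q∣≤∣p∣⇒q⊆p (inside  ∷ p) (_       ∷ q) ∣p∪q∣≤∣p∣ (there x∈q) =
  there (∣p∪q∣≤∣p∣⇒q⊆p p q (ℕ.≤-pred ∣p∪q∣≤∣p∣) x∈q)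
∣p∪q∣≤∣p∣⇒q⊆p (outside ∷ p) (outside ∷ q) ∣p∪q∣≤∣p∣ (there x∈q) =
  there (∣p∪q∣≤∣p∣⇒q⊆p p q ∣p∪q∣≤∣p∣ x∈q)

∣p∣+m≡n⇒∣∁p∣≡m : ∀ {n m} (p : Subset n) → ∣ p ∣ + m ≡ n → ∣ ∁ p ∣ ≡ m
∣p∣+m≡n⇒∣∁p∣≡m {m = m} p ∣p∣+m≡n =
  trans (∣∁p∣≡n∸∣p∣ p) (trans (cong (_∸ ∣ p ∣) (sym ∣p∣+m≡n)) (ℕ.m+n∸m≡n ∣ p ∣ m))

∁∁p⊆p : ∀ {n} (p : Subset n) → ∁ (∁ p) ⊆ p
∁∁p⊆p p = x∉∁p⇒x∈p ∘ x∈∁p⇒x∉p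

record Dependence {n D : ℕ} (w : Fin n → Fin D → ℚ) (U : Subset n) (K : Subset D) : Set where
  field
    coeff       : Fin n → ℚ
    supported   : ∀ {i} → i ∉ U → coeff i ≡ 0ℚ
    nontrivial  : ∃ λ i → i ∈ U × coeff i ≢ 0ℚ
    annihilates : ∀ {k} → k ∈ K → sum (λ i → coeff i *ℚ w i k) ≡ 0ℚ

eliminate : ∀ {n D} → (Fin n → Fin (suc D) → ℚ) → Fin n → Fin n → Fin D → ℚ
eliminate w p i k = w p zero *ℚ w i (suc k) -ℚ w i zero *ℚ w p (suc k)

∑-μ*eliminate : ∀ {n D} (w : Fin n → Fin (suc D) → ℚ) (p : Fin n) (μ : Fin n → ℚ) (k : Fin D) →
                let s = sum (λ i → μ i *ℚ w i zero) in
                sum (λ i → μ i *ℚ eliminate w p i k) ≡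
                w p zero *ℚ sum (λ i → μ i *ℚ w i (suc k)) +ℚ (-ℚ s) *ℚ w p (suc k)
∑-μ*eliminate w p μ k = begin
  sum (λ i → μ i *ℚ eliminate w p i k)
    ≡⟨ sum-cong-≗ (λ i → solve 5 (λ a m x y z → m :* (a :* x :- y :* z)
                                               := a :* (m :* x) :+ (:- z) :* (m :* y))
                                 refl a (μ i) (w i (suc k)) (w i zero) z) ⟩
  sum (λ i → a *ℚ (μ i *ℚ w i (suc k)) +ℚ (-ℚ z) *ℚ (μ i *ℚ w i zero))
    ≡⟨ ∑-linear a (-ℚ z) (λ i → μ i *ℚ w i (suc k)) (λ i → μ i *ℚ w i zero) ⟩
  a *ℚ sum (λ i → μ i *ℚ w i (suc k)) +ℚ (-ℚ z) *ℚ s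
    ≡⟨ cong (a *ℚ sum (λ i → μ i *ℚ w i (suc k)) +ℚ_)
            (solve 2 (λ z s → (:- z) :* s := (:- s) :* z) refl z s) ⟩
  a *ℚ sum (λ i → μ i *ℚ w i (suc k)) +ℚ (-ℚ s) *ℚ z
    ∎
  where
  open ≡-Reasoning
  a = w p zero
  z = w p (suc k)
  s = sum (λ i → μ i *ℚ w i zero)

-- Turns a dependence μ of the rows eliminate w p into one of the rows w; the δ p term
-- cancels coordinate zero.
pivotLift : ∀ {n D} → (Fin n → Fin (suc D) → ℚ) → Fin n → (Fin n → ℚ) → Fin n → ℚ
pivotLift w p μ i = w p zero *ℚ μ i +ℚ (-ℚ sum (λ j → μ j *ℚ w j zero)) *ℚ δ p i

pivotLift-offPivot : ∀ {n D} (w : Fin n → Fin (suc D) → ℚ) {p i} (μ : Fin n → ℚ) →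
                     p ≢ i → pivotLift w p μ i ≡ w p zero *ℚ μ i
pivotLift-offPivot w {p} {i} μ p≢i =
  trans (cong (λ t → w p zero *ℚ μ i +ℚ (-ℚ s) *ℚ t) (δ-≢ p≢i))
        (solve 2 (λ x s → x :+ (:- s) :* con 0ℚ := x) refl (w p zero *ℚ μ i) s)
  where s = sum (λ j → μ j *ℚ w j zero)

dependence-[] : ∀ {n} {w : Fin n → Fin 0 → ℚ} {U : Subset n} → Nonempty U → Dependence w U []
dependence-[] {U = U} (p , p∈U) = record
  { coeff       = δ p
  ; supported   = λ i∉U → δ-≢ (λ p≡i → i∉U (subst (_∈ U) p≡i p∈U))
  ; nontrivial  = p , p∈U , λ δpp≡0 → 1≢0 (trans (sym (δ-diag p)) δpp≡0)
  ; annihilates = λ ()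
  }

module _ {n D : ℕ} {w : Fin n → Fin (suc D) → ℚ} {U : Subset n} {K : Subset D} where

  dependence-skip : Dependence (λ i k → w i (suc k)) U K → Dependence w U (outside ∷ K)
  dependence-skip dep = record
    { coeff       = coeff
    ; supported   = supported
    ; nontrivial  = nontrivial
    ; annihilates = λ { (there k∈K) → annihilates k∈K }
    }
    where open Dependence dep

  dependence-zeroColumn : (∀ {i} → i ∈ U → w i zero ≡ 0ℚ) →
                          Dependence (λ i k → w i (suc k)) U K → Dependence w U (inside ∷ K)
  dependence-zeroColumn zeroColumn dep = record
    { coeff       = coeff
    ; supported   = supported
    ; nontrivial  = nontrivial
    ; annihilates = λ { here → ∑-zero vanishes ; (there k∈K) → annihilates k∈K }
    }
    where
    open Dependence dep
    vanishes : ∀ i → coeff i *ℚ w i zero ≡ 0ℚ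
    vanishes i with i ∈? U
    ... | yes i∈U = trans (cong (coeff i *ℚ_) (zeroColumn i∈U)) (*-zeroʳ (coeff i))
    ... | no  i∉U = trans (cong (_*ℚ w i zero) (supported i∉U)) (*-zeroˡ (w i zero))

  dependence-pivot : ∀ {p} → p ∈ U → w p zero ≢ 0ℚ →
                     Dependence (eliminate w p) (U - p) K → Dependence w U (inside ∷ K)
  dependence-pivot {p} p∈U a≢0 dep = record
    { coeff       = pivotLift w p μ
    ; supported   = supported′
    ; nontrivial  = i₀ , p─q⊆p U ⁅ p ⁆ i₀∈U-p , coeff≢0
    ; annihilates = λ
        { here        → trans (∑-[aμ+bδ]*y a (-ℚ s) μ (λ i → w i zero) p)
                              (solve 2 (λ a s → a :* s :+ (:- s) :* a := con 0ℚ) refl a s)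
        ; (there k∈K) → trans (∑-[aμ+bδ]*y a (-ℚ s) μ (λ i → w i (suc _)) p)
                              (trans (sym (∑-μ*eliminate w p μ _)) (annihilates k∈K))
        }
    }
    where
    open Dependence dep renaming (coeff to μ)
    a = w p zero
    s = sum (λ i → μ i *ℚ w i zero)
    supported′ : ∀ {i} → i ∉ U → pivotLift w p μ i ≡ 0ℚ
    supported′ {i} i∉U = begin
      pivotLift w p μ i  ≡⟨ pivotLift-offPivot w μ (λ p≡i → i∉U (subst (_∈ U) p≡i p∈U)) ⟩
      a *ℚ μ i           ≡⟨ cong (a *ℚ_) (supported (i∉U ∘ p─q⊆p U ⁅ p ⁆)) ⟩
      a *ℚ 0ℚ            ≡⟨ *-zeroʳ a ⟩
      0ℚ                 ∎
      where open ≡-Reasoning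
    i₀ = proj₁ nontrivial
    i₀∈U-p = proj₁ (proj₂ nontrivial)
    p≢i₀ : p ≢ i₀
    p≢i₀ p≡i₀ = x∉⁅y⁆⇒x≢y (x∈p─q⇒x∉q U ⁅ p ⁆ i₀∈U-p) (sym p≡i₀)
    coeff≢0 : pivotLift w p μ i₀ ≢ 0ℚ
    coeff≢0 = subst (_≢ 0ℚ) (sym (pivotLift-offPivot w μ p≢i₀))
                    (x#0y#0→xy#0 a≢0 (proj₂ (proj₂ nontrivial)))

dependence : ∀ {n D} (w : Fin n → Fin D → ℚ) (U : Subset n) (K : Subset D) →
             ∣ K ∣ < ∣ U ∣ → Dependence w U K
dependence w U []            ∣K∣<∣U∣ = dependence-[] (<∣p∣⇒Nonempty U ∣K∣<∣U∣)
dependence w U (outside ∷ K) ∣K∣<∣U∣ = dependence-skip (dependence (λ i k → w i (suc k)) U K ∣K∣<∣U∣)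
dependence w U (inside  ∷ K) ∣K∣<∣U∣ with any? (λ p → (p ∈? U) ×-dec ¬? (w p zero ≟ℚ 0ℚ))
... | yes (p , p∈U , pivot) =
  dependence-pivot p∈U pivot (dependence (eliminate w p) (U - p) K ∣K∣<∣U-p∣)
  where ∣K∣<∣U-p∣ = ℕ.≤-pred (ℕ.≤-trans ∣K∣<∣U∣ (∣p∣≤1+∣p-x∣ U p))
... | no noPivot =
  dependence-zeroColumn zeroColumn (dependence (λ i k → w i (suc k)) U K (ℕ.<⇒≤ ∣K∣<∣U∣))
  where
  zeroColumn : ∀ {i} → i ∈ U → w i zero ≡ 0ℚ
  zeroColumn {i} i∈U = decidable-stable (w i zero ≟ℚ 0ℚ) (λ w≢0 → noPivot (i , i∈U , w≢0))

homogeneous : ∀ {d} → Vertices d → Fin (suc d) → Fin (suc d) → ℚ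
homogeneous v i zero    = 1ℚ
homogeneous v i (suc k) = toℚ (v i k)

AffineIn : ∀ {d} → Vertices d → Subset (suc d) → Fin d → Fin d → Set
AffineIn v U k′ k = ∃₂ λ a b → ∀ {i} → i ∈ U → toℚ (v i k) ≡ a +ℚ b *ℚ toℚ (v i k′)

interpolate : (x₁ x₂ y₁ y₂ : Bool) → y₁ ≢ y₂ →
              ∃₂ λ a b → toℚ x₁ ≡ a +ℚ b *ℚ toℚ y₁ × toℚ x₂ ≡ a +ℚ b *ℚ toℚ y₂
interpolate x₁ x₂ true  false _ = toℚ x₂ , toℚ x₁ -ℚ toℚ x₂ ,
  solve 2 (λ x₁ x₂ → x₁ := x₂ :+ (x₁ :- x₂) :* con 1ℚ) refl (toℚ x₁) (toℚ x₂) ,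
  solve 2 (λ x₁ x₂ → x₂ := x₂ :+ (x₁ :- x₂) :* con 0ℚ) refl (toℚ x₁) (toℚ x₂)
interpolate x₁ x₂ false true  _ = toℚ x₁ , toℚ x₂ -ℚ toℚ x₁ ,
  solve 2 (λ x₁ x₂ → x₁ := x₁ :+ (x₂ :- x₁) :* con 0ℚ) refl (toℚ x₁) (toℚ x₂) ,
  solve 2 (λ x₁ x₂ → x₂ := x₁ :+ (x₂ :- x₁) :* con 1ℚ) refl (toℚ x₁) (toℚ x₂)
interpolate _  _  true  true  y₁≢y₂ = contradiction refl y₁≢y₂
interpolate _  _  false false y₁≢y₂ = contradiction refl y₁≢y₂

module _ {d : ℕ} {v : Vertices d} where

  InCubeFace-⊆ : ∀ {T C C′ c} → C′ ⊆ C → InCubeFace v T C c → InCubeFace v T C′ c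
  InCubeFace-⊆ C′⊆C inFace i k i∈T k∈C′ = inFace i k i∈T (C′⊆C k∈C′)

  InCubeFace-∪ : ∀ {T₁ T₂ C c} → InCubeFace v T₁ C c → InCubeFace v T₂ C c →
                 InCubeFace v (T₁ ∪ T₂) C c
  InCubeFace-∪ {T₁} {T₂} inFace₁ inFace₂ i k i∈T₁∪T₂ k∈C with x∈p∪q⁻ T₁ T₂ i∈T₁∪T₂
  ... | inj₁ i∈T₁ = inFace₁ i k i∈T₁ k∈C
  ... | inj₂ i∈T₂ = inFace₂ i k i∈T₂ k∈C

  cubeFaceCoords⇒InCubeFace : ∀ {T S i} → CubeFaceCoords v T S → i ∈ T → InCubeFace v T (∁ S) (v i)
  cubeFaceCoords⇒InCubeFace {i = i} coords i∈T i′ k i′∈T k∈∁S =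
    decidable-stable (v i′ k Bool.≟ v i k)
      (λ v≢ → x∈∁p⇒x∉p k∈∁S (proj₂ (coords k) (i′ , i , i′∈T , i∈T , v≢)))

  ∣S∣<∣T∣ : ∀ {j T S} → IsExteriorFace v j T → CubeFaceCoords v T S → ∣ S ∣ < ∣ T ∣
  ∣S∣<∣T∣ {j} {T} {S} (∣T∣≡1+j , C , c , ∣C∣+j≡d , inFace) coords = begin-strict
    ∣ S ∣    ≤⟨ p⊆q⇒∣p∣≤∣q∣ S⊆∁C ⟩
    ∣ ∁ C ∣  ≡⟨ ∣p∣+m≡n⇒∣∁p∣≡m C ∣C∣+j≡d ⟩
    j        <⟨ ℕ.n<1+n j ⟩
    suc j    ≡⟨ ∣T∣≡1+j ⟨
    ∣ T ∣    ∎
    where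
    open ℕ.≤-Reasoning
    S⊆∁C : S ⊆ ∁ C
    S⊆∁C {k} k∈S with proj₁ (coords k) k∈S
    ... | i , i′ , i∈T , i′∈T , v≢ =
      x∉p⇒x∈∁p (λ k∈C → v≢ (trans (inFace i k i∈T k∈C) (sym (inFace i′ k i′∈T k∈C))))

  module _ (independent : AffinelyIndependent v) where

    -- A linear dependence of the vectors (1, v i), i ∈ U, on the coordinates in F extends to
    -- every coordinate, so it is an affine dependence of the vertices.
    ∣U∣≤1+∣F∣ : (U : Subset (suc d)) (F : Subset d) →
                (∀ {k} → k ∉ F → ∃ λ k′ → k′ ∈ F × AffineIn v U k′ k) → ∣ U ∣ ≤ suc ∣ F ∣
    ∣U∣≤1+∣F∣ U F affine with suc ∣ F ∣ ℕ.<? ∣ U ∣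
    ... | no  ∣F∣≮∣U∣ = ℕ.≮⇒≥ ∣F∣≮∣U∣
    ... | yes ∣F∣<∣U∣ = contradiction (independent coeff ∑coeff≡0 ∑coord≡0 i₀) coeff≢0
      where
      open Dependence (dependence (homogeneous v) U (inside ∷ F) ∣F∣<∣U∣)
      i₀ = proj₁ nontrivial
      coeff≢0 = proj₂ (proj₂ nontrivial)
      ∑coeff≡0 : sumℚ (suc d) coeff ≡ 0ℚ
      ∑coeff≡0 = trans (sumℚ≡sum _ coeff)
                       (trans (sum-cong-≗ (λ i → sym (*-identityʳ (coeff i)))) (annihilates here))
      ∑coord≡0 : ∀ k → sumℚ (suc d) (λ i → coeff i *ℚ toℚ (v i k)) ≡ 0ℚ
      ∑coord≡0 k with k ∈? F
      ... | yes k∈F = trans (sumℚ≡sum _ (λ i → coeff i *ℚ toℚ (v i k))) (annihilates (there k∈F))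
      ... | no  k∉F with affine k∉F
      ...   | k′ , k′∈F , a , b , k≡a+bk′ = begin
        sumℚ (suc d) (λ i → coeff i *ℚ toℚ (v i k))
          ≡⟨ sumℚ≡sum _ (λ i → coeff i *ℚ toℚ (v i k)) ⟩
        sum (λ i → coeff i *ℚ toℚ (v i k))
          ≡⟨ sum-cong-≗ pointwise ⟩
        sum (λ i → a *ℚ coeff i +ℚ b *ℚ (coeff i *ℚ toℚ (v i k′)))
          ≡⟨ ∑-linear a b coeff (λ i → coeff i *ℚ toℚ (v i k′)) ⟩
        a *ℚ sum coeff +ℚ b *ℚ sum (λ i → coeff i *ℚ toℚ (v i k′))
          ≡⟨ cong₂ (λ x y → a *ℚ x +ℚ b *ℚ y) (trans (sym (sumℚ≡sum _ coeff)) ∑coeff≡0)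
                                                (annihilates (there k′∈F)) ⟩
        a *ℚ 0ℚ +ℚ b *ℚ 0ℚ
          ≡⟨ solve 2 (λ a b → a :* con 0ℚ :+ b :* con 0ℚ := con 0ℚ) refl a b ⟩
        0ℚ
          ∎
        where
        open ≡-Reasoning
        pointwise : ∀ i → coeff i *ℚ toℚ (v i k) ≡ a *ℚ coeff i +ℚ b *ℚ (coeff i *ℚ toℚ (v i k′))
        pointwise i with i ∈? U
        ... | yes i∈U rewrite k≡a+bk′ i∈U =
          solve 4 (λ c a b x → c :* (a :+ b :* x) := a :* c :+ b :* (c :* x))
                  refl (coeff i) a b (toℚ (v i k′))
        ... | no  i∉U rewrite supported i∉U =
          solve 4 (λ a b x y → con 0ℚ :* x := a :* con 0ℚ :+ b :* (con 0ℚ :* y))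
                  refl a b (toℚ (v i k)) (toℚ (v i k′))

    face-card : ∀ {U F c} → Nonempty F → InCubeFace v U (∁ F) c → ∣ U ∣ ≤ suc ∣ F ∣
    face-card {U} {F} {c} (k′ , k′∈F) inFace = ∣U∣≤1+∣F∣ U F constant
      where
      constant : ∀ {k} → k ∉ F → ∃ λ k′ → k′ ∈ F × AffineIn v U k′ k
      constant {k} k∉F = k′ , k′∈F , toℚ (c k) , 0ℚ , λ {i} i∈U →
        trans (cong toℚ (inFace i k i∈U (x∉p⇒x∈∁p k∉F)))
              (solve 2 (λ x y → x := x :+ con 0ℚ :* y) refl (toℚ (c k)) (toℚ (v i k′)))

    parallelFaces-card : ∀ {T₁ T₂ F c₁ c₂ k₀} →
                         InCubeFace v T₁ (∁ F) c₁ → InCubeFace v T₂ (∁ F) c₂ →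
                         k₀ ∈ ∁ F → c₁ k₀ ≢ c₂ k₀ → ∣ T₁ ∣ + ∣ T₂ ∣ ≤ 2 + ∣ F ∣
    parallelFaces-card {T₁} {T₂} {F} {c₁} {c₂} {k₀} inFace₁ inFace₂ k₀∈∁F c₁≢c₂ = begin
      ∣ T₁ ∣ + ∣ T₂ ∣          ≡⟨ ∣p∪q∣≡∣p∣+∣q∣ T₁ T₂ separated ⟨
      ∣ T₁ ∪ T₂ ∣              ≤⟨ ∣U∣≤1+∣F∣ (T₁ ∪ T₂) (⁅ k₀ ⁆ ∪ F) affine ⟩
      suc ∣ ⁅ k₀ ⁆ ∪ F ∣       ≡⟨ cong suc (∣p∪q∣≡∣p∣+∣q∣ ⁅ k₀ ⁆ F k₀∉F) ⟩
      suc (∣ ⁅ k₀ ⁆ ∣ + ∣ F ∣) ≡⟨ cong (λ m → suc (m + ∣ F ∣)) (∣⁅x⁆∣≡1 k₀) ⟩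
      2 + ∣ F ∣                ∎
      where
      open ℕ.≤-Reasoning
      separated : ∀ {i} → i ∈ T₁ → i ∉ T₂
      separated {i} i∈T₁ i∈T₂ =
        c₁≢c₂ (trans (sym (inFace₁ i k₀ i∈T₁ k₀∈∁F)) (inFace₂ i k₀ i∈T₂ k₀∈∁F))
      k₀∉F : ∀ {k} → k ∈ ⁅ k₀ ⁆ → k ∉ F
      k₀∉F k∈⁅k₀⁆ = x∈∁p⇒x∉p (subst (_∈ ∁ F) (sym (x∈⁅y⁆⇒x≡y k₀ k∈⁅k₀⁆)) k₀∈∁F)
      affine : ∀ {k} → k ∉ ⁅ k₀ ⁆ ∪ F → ∃ λ k′ → k′ ∈ ⁅ k₀ ⁆ ∪ F × AffineIn v (T₁ ∪ T₂) k′ k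
      affine {k} k∉⁅k₀⁆∪F with interpolate (c₁ k) (c₂ k) (c₁ k₀) (c₂ k₀) c₁≢c₂
      ... | a , b , on₁ , on₂ = k₀ , x∈p∪q⁺ (inj₁ (x∈⁅x⁆ k₀)) , a , b , onBoth
        where
        k∈∁F : k ∈ ∁ F
        k∈∁F = x∉p⇒x∈∁p (k∉⁅k₀⁆∪F ∘ x∈p∪q⁺ ∘ inj₂)
        onBoth : ∀ {i} → i ∈ T₁ ∪ T₂ → toℚ (v i k) ≡ a +ℚ b *ℚ toℚ (v i k₀)
        onBoth {i} i∈T₁∪T₂ with x∈p∪q⁻ T₁ T₂ i∈T₁∪T₂
        ... | inj₁ i∈T₁ rewrite inFace₁ i k i∈T₁ k∈∁F | inFace₁ i k₀ i∈T₁ k₀∈∁F = on₁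
        ... | inj₂ i∈T₂ rewrite inFace₂ i k i∈T₂ k∈∁F | inFace₂ i k₀ i∈T₂ k₀∈∁F = on₂

    ¬distinctParallelFaces : ∀ {T₁ T₂ F c₁ c₂ k₀} → 0 < ∣ F ∣ → ∣ F ∣ < ∣ T₁ ∣ → ∣ F ∣ < ∣ T₂ ∣ →
                             InCubeFace v T₁ (∁ F) c₁ → InCubeFace v T₂ (∁ F) c₂ →
                             k₀ ∈ ∁ F → c₁ k₀ ≢ c₂ k₀ → ⊥
    ¬distinctParallelFaces 0<∣F∣ ∣F∣<∣T₁∣ ∣F∣<∣T₂∣ inFace₁ inFace₂ k₀∈∁F c₁≢c₂ =
      ℕ.<⇒≱ (2+m<a+b 0<∣F∣ ∣F∣<∣T₁∣ ∣F∣<∣T₂∣) (parallelFaces-card inFace₁ inFace₂ k₀∈∁F c₁≢c₂)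

    commonFace⇒⊆ : ∀ {T₁ T₂ F c} → Nonempty F → ∣ F ∣ < ∣ T₁ ∣ →
                   InCubeFace v T₁ (∁ F) c → InCubeFace v T₂ (∁ F) c → T₂ ⊆ T₁
    commonFace⇒⊆ {T₁} {T₂} F≢∅ ∣F∣<∣T₁∣ inFace₁ inFace₂ =
      ∣p∪q∣≤∣p∣⇒q⊆p T₁ T₂ (ℕ.≤-trans (face-card F≢∅ (InCubeFace-∪ inFace₁ inFace₂)) ∣F∣<∣T₁∣)

    sameFreeCoords⇒≡ : ∀ {T₁ T₂ F c₁ c₂} → Nonempty F → ∣ F ∣ < ∣ T₁ ∣ → ∣ F ∣ < ∣ T₂ ∣ →
                       InCubeFace v T₁ (∁ F) c₁ → InCubeFace v T₂ (∁ F) c₂ → T₁ ≡ T₂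
    sameFreeCoords⇒≡ {F = F} {c₁} {c₂} F≢∅ ∣F∣<∣T₁∣ ∣F∣<∣T₂∣ inFace₁ inFace₂
      with any? (λ k → (k ∈? ∁ F) ×-dec ¬? (c₁ k Bool.≟ c₂ k))
    ... | yes (k₀ , k₀∈∁F , c₁≢c₂) = ⊥-elim (¬distinctParallelFaces (Nonempty⇒0<∣p∣ F≢∅)
                                       ∣F∣<∣T₁∣ ∣F∣<∣T₂∣ inFace₁ inFace₂ k₀∈∁F c₁≢c₂)
    ... | no c₁≈c₂ = ⊆-antisym (commonFace⇒⊆ F≢∅ ∣F∣<∣T₂∣ inFace₂′ inFace₁)
                               (commonFace⇒⊆ F≢∅ ∣F∣<∣T₁∣ inFace₁ inFace₂′)
      where
      inFace₂′ : InCubeFace v _ (∁ F) c₁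
      inFace₂′ i k i∈T₂ k∈∁F = trans (inFace₂ i k i∈T₂ k∈∁F)
        (decidable-stable (c₂ k Bool.≟ c₁ k) (λ c₂≢c₁ → c₁≈c₂ (k , k∈∁F , c₂≢c₁ ∘ sym)))

    ¬parallelExteriorFaces : ∀ {j T₁ T₂ C c₁ c₂ k₀} → 0 < j → ∣ T₁ ∣ ≡ suc j → ∣ T₂ ∣ ≡ suc j →
                             ∣ C ∣ + j ≡ d → k₀ ∈ C → c₁ k₀ ≢ c₂ k₀ →
                             InCubeFace v T₁ C c₁ → InCubeFace v T₂ C c₂ → ⊥
    ¬parallelExteriorFaces {j} {T₁} {T₂} {C} 0<j ∣T₁∣≡1+j ∣T₂∣≡1+j ∣C∣+j≡d k₀∈C c₁≢c₂
                           inFace₁ inFace₂ =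
      ¬distinctParallelFaces (subst (0 <_) (sym ∣∁C∣≡j) 0<j)
        (∣∁C∣<∣T∣ T₁ ∣T₁∣≡1+j) (∣∁C∣<∣T∣ T₂ ∣T₂∣≡1+j)
        (InCubeFace-⊆ (∁∁p⊆p C) inFace₁) (InCubeFace-⊆ (∁∁p⊆p C) inFace₂)
        (x∉p⇒x∈∁p (x∈p⇒x∉∁p k₀∈C)) c₁≢c₂
      where
      ∣∁C∣≡j = ∣p∣+m≡n⇒∣∁p∣≡m C ∣C∣+j≡d
      ∣∁C∣<∣T∣ : ∀ T → ∣ T ∣ ≡ suc j → ∣ ∁ C ∣ < ∣ T ∣
      ∣∁C∣<∣T∣ T ∣T∣≡1+j = ℕ.≤-reflexive (trans (cong suc ∣∁C∣≡j) (sym ∣T∣≡1+j))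

    exteriorFace-unique : ∀ {S T₁ T₂ j₁ j₂} → Nonempty S →
                          IsExteriorFace v j₁ T₁ → CubeFaceCoords v T₁ S →
                          IsExteriorFace v j₂ T₂ → CubeFaceCoords v T₂ S → T₁ ≡ T₂
    exteriorFace-unique {T₁ = T₁} {T₂} S≢∅ exterior₁ coords₁ exterior₂ coords₂ =
      sameFreeCoords⇒≡ S≢∅ ∣S∣<∣T₁∣ ∣S∣<∣T₂∣
        (cubeFaceCoords⇒InCubeFace coords₁ (proj₂ (<∣p∣⇒Nonempty T₁ ∣S∣<∣T₁∣)))
        (cubeFaceCoords⇒InCubeFace coords₂ (proj₂ (<∣p∣⇒Nonempty T₂ ∣S∣<∣T₂∣)))
      where
      ∣S∣<∣T₁∣ = ∣S∣<∣T∣ exterior₁ coords₁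
      ∣S∣<∣T₂∣ = ∣S∣<∣T∣ exterior₂ coords₂

mainTheorem8 : (d : ℕ) → (α : NondegSimplex d) →
    ((j : ℕ) → 0 < j →
      ¬ (∃ λ (T₁ : Subset (suc d)) → ∃ λ (T₂ : Subset (suc d)) →
         ∃ λ (C : Subset d) → ∃ λ (c₁ : Point d) → ∃ λ (c₂ : Point d) →
           ∣ T₁ ∣ ≡ suc j × ∣ T₂ ∣ ≡ suc j ×
           ∣ C ∣ + j ≡ d ×
           (∃ λ k → k ∈ C × c₁ k ≢ c₂ k) ×
           InCubeFace (proj₁ α) T₁ C c₁ × InCubeFace (proj₁ α) T₂ C c₂))
    ×
    ((S : Subset d) → Nonempty S →
      (T₁ T₂ : Subset (suc d)) → (j₁ j₂ : ℕ) →
      IsExteriorFace (proj₁ α) j₁ T₁ → CubeFaceCoords (proj₁ α) T₁ S →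
      IsExteriorFace (proj₁ α) j₂ T₂ → CubeFaceCoords (proj₁ α) T₂ S →
      T₁ ≡ T₂)
mainTheorem8 d (v , independent) =
  (λ { j 0<j (T₁ , T₂ , C , c₁ , c₂ , ∣T₁∣ , ∣T₂∣ , ∣C∣+j , (k₀ , k₀∈C , c₁≢c₂) , inFace₁ , inFace₂) →
         ¬parallelExteriorFaces independent 0<j ∣T₁∣ ∣T₂∣ ∣C∣+j k₀∈C c₁≢c₂ inFace₁ inFace₂ }) ,
  λ S S≢∅ T₁ T₂ j₁ j₂ → exteriorFace-unique independent S≢∅
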